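{- Let $v$ and $\lambda$ be positive integers. If a completely uniform nested $2$-$(v,4,\lambda)$ design exists, then $\lambda \equiv 0 \pmod 3$.
   Context: A $2$-$(v,4,\lambda)$ design is a pair $(V,\mathcal{B})$ with $|V|=v$ and $\mathcal{B}$ a collection of $4$-subsets (blocks) of $V$ such that every $2$-subset of $V$ is contained in exactly $\lambda$ blocks. A nested $2$-$(v,4,\lambda)$ design is a pair $(V,\mathscr{B})$ where each element of $\mathscr{B}$ is a partition $\{\{x,y\},\{z,w\}\}$ (written $\{x,y\mid z,w\}$) of a $4$-set into two pairs, such that $(V,\{\{x,y,z,w\} : \{x,y\mid z,w\}\in\mathscr{B}\})$ is a $2$-$(v,4,\lambda)$ design (each block is partitioned once). The multiplicity of a pair $\{x,y\}\in\binom{V}{2}$ is the number of elements of $\mathscr{B}$ having $\{x,y\}$ as one of its two parts. The nested design is completely uniform if every pair in $\binom{V}{2}$ has the same positive multiplicity. -}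

module Defs where

open import Data.Nat using (ℕ; zero; suc; _<_)
open import Data.Product using (Σ; _×_)
open import Data.Fin using (Fin)
open import Data.Fin.Properties using (_≟_)
open import Data.List using (List; []; _∷_)
open import Data.Bool using (Bool; true; false; _∧_; _∨_; if_then_else_)
open import Relation.Nullary.Decidable using (⌊_⌋)
open import Relation.Binary.PropositionalEquality using (_≡_)
open import Relation.Nullary using (¬_)

-- A nested block {x,y | z,w} on the point set Fin v: four pairwise distinct
-- points, partitioned into the two parts {x,y} and {z,w}.
record NestedBlock (v : ℕ) : Set where
  constructor ⟨_,_∣_,_⟩[_,_,_,_,_,_]
  field
    x y z w : Fin v
    x≢y : ¬ x ≡ y
    x≢z : ¬ x ≡ z
    x≢w : ¬ x ≡ w
    y≢z : ¬ y ≡ z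
    y≢w : ¬ y ≡ w
    z≢w : ¬ z ≡ w

open NestedBlock public

_==_ : {v : ℕ} → Fin v → Fin v → Bool
a == b = ⌊ a ≟ b ⌋

_∈B_ : {v : ℕ} → Fin v → NestedBlock v → Bool
a ∈B B = (a == x B) ∨ (a == y B) ∨ (a == z B) ∨ (a == w B)

samePair : {v : ℕ} → Fin v → Fin v → Fin v → Fin v → Bool
samePair a b c d = ((a == c) ∧ (b == d)) ∨ ((a == d) ∧ (b == c))

isPart : {v : ℕ} → Fin v → Fin v → NestedBlock v → Bool
isPart a b B = samePair a b (x B) (y B) ∨ samePair a b (z B) (w B)

countB : {A : Set} → (A → Bool) → List A → ℕ
countB p [] = 0
countB p (B ∷ Bs) = if p B then suc (countB p Bs) else countB p Bs

blocksThrough : {v : ℕ} → List (NestedBlock v) → Fin v → Fin v → ℕ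
blocksThrough ℬ a b = countB (λ B → (a ∈B B) ∧ (b ∈B B)) ℬ

multiplicity : {v : ℕ} → List (NestedBlock v) → Fin v → Fin v → ℕ
multiplicity ℬ a b = countB (isPart a b) ℬ

-- (Fin v, ℬ) is a nested 2-(v,4,λ) design: the underlying blocks
-- (a multiset, given as a list) form a 2-(v,4,λ) design.
IsNestedDesign : (v λ' : ℕ) → List (NestedBlock v) → Set
IsNestedDesign v λ' ℬ = ∀ (a b : Fin v) → ¬ a ≡ b → blocksThrough ℬ a b ≡ λ'

CompletelyUniform : (v : ℕ) → List (NestedBlock v) → Set
CompletelyUniform v ℬ =
  Σ ℕ (λ μ → (0 < μ) × (∀ (a b : Fin v) → ¬ a ≡ b → multiplicity ℬ a b ≡ μ))

{-# OPTIONS --safe #-}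
module Submission where

-- Fix a point a and let r be the number of blocks through it.  Counting pairs
-- (b, B) with a, b ∈ B gives 4r = r + (v - 1)λ, since every block through a
-- has three further points.  Counting pairs (b, B) with {a, b} a part of B
-- gives r = (v - 1)μ, since a lies in exactly one part of each block through
-- it and has exactly one partner there.  Hence λ = 3μ.

open import Defs
open import Data.Nat using (ℕ; zero; suc; s≤s; z≤n; _+_; _*_; _≤_; _<_; _%_)
open import Data.Nat.Properties using (+-*-semiring; *-commutativeSemigroup; +-cancelˡ-≡; *-cancelˡ-≡; *-zeroʳ; *-identityˡ; *-identityʳ; +-identityʳ; *-distribˡ-+; *-comm)
open import Data.Nat.Divisibility using (divides; n∣m⇒m%n≡0)
open import Algebra.Properties.CommutativeSemigroup *-commutativeSemigroup using (x∙yz≈y∙xz)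
open import Algebra.Properties.Semiring.Sum +-*-semiring using (sum; *-distribˡ-sum; sum-remove; sum-cong-≗; sum-replicate-zero; ∑-distrib-+)
open import Data.List using (List; []; _∷_)
open import Data.Product using (Σ; _×_; _,_)
open import Data.Bool using (Bool; true; false; _∧_; _∨_)
open import Data.Bool.Properties using (∧-idem; ∧-comm; ∨-assoc)
open import Data.Fin using (Fin; punchIn)
open import Data.Fin.Patterns using (0F)
open import Data.Fin.Properties using (_≟_; punchInᵢ≢i)
open import Function using (_∘_)
open import Relation.Nullary using (yes; no)
open import Relation.Nullary.Decidable using (isYes≗does; dec-true; dec-false)
open import Relation.Binary.PropositionalEquality using (_≡_; _≢_; refl; sym; trans; cong; cong₂; module ≡-Reasoning)

open ≡-Reasoning

ind : Bool → ℕ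
ind true  = 1
ind false = 0

ind-∨-disjoint₄ : ∀ p q r s →
  p ∧ q ≡ false → p ∧ r ≡ false → p ∧ s ≡ false →
  q ∧ r ≡ false → q ∧ s ≡ false → r ∧ s ≡ false →
  ind (p ∨ q ∨ r ∨ s) ≡ ind p + (ind q + (ind r + ind s))
ind-∨-disjoint₄ false false false false _ _ _ _ _ _ = refl
ind-∨-disjoint₄ true  false false false _ _ _ _ _ _ = refl
ind-∨-disjoint₄ false true  false false _ _ _ _ _ _ = refl
ind-∨-disjoint₄ false false true  false _ _ _ _ _ _ = refl
ind-∨-disjoint₄ false false false true  _ _ _ _ _ _ = refl
ind-∨-disjoint₄ true  true  _     _     () _  _  _  _  _
ind-∨-disjoint₄ true  false true  _     _  () _  _  _  _
ind-∨-disjoint₄ true  false false true  _  _  () _  _  _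
ind-∨-disjoint₄ false true  true  _     _  _  _  () _  _
ind-∨-disjoint₄ false true  false true  _  _  _  _  () _
ind-∨-disjoint₄ false false true  true  _  _  _  _  _  ()

∧-disjoint-weaken : ∀ p q r s → p ∧ q ≡ false → (p ∧ r) ∧ (q ∧ s) ≡ false
∧-disjoint-weaken false q     r s _ = refl
∧-disjoint-weaken true  false r s _ = ∧-comm r false
∧-disjoint-weaken true  true  r s ()

ind-∧ : ∀ p q → ind (p ∧ q) ≡ ind p * ind q
ind-∧ true  q = sym (+-identityʳ (ind q))
ind-∧ false q = refl

ind-∨-disjoint₄-∧ : ∀ p q r s p′ q′ r′ s′ →
  p ∧ q ≡ false → p ∧ r ≡ false → p ∧ s ≡ false →
  q ∧ r ≡ false → q ∧ s ≡ false → r ∧ s ≡ false →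
  ind (((p ∧ p′) ∨ (q ∧ q′)) ∨ ((r ∧ r′) ∨ (s ∧ s′))) ≡
  ind p * ind p′ + (ind q * ind q′ + (ind r * ind r′ + ind s * ind s′))
ind-∨-disjoint₄-∧ p q r s p′ q′ r′ s′ pq pr ps qr qs rs = begin
  ind (((p ∧ p′) ∨ (q ∧ q′)) ∨ ((r ∧ r′) ∨ (s ∧ s′)))
    ≡⟨ cong ind (∨-assoc (p ∧ p′) (q ∧ q′) _) ⟩
  ind ((p ∧ p′) ∨ (q ∧ q′) ∨ (r ∧ r′) ∨ (s ∧ s′))
    ≡⟨ ind-∨-disjoint₄ (p ∧ p′) (q ∧ q′) (r ∧ r′) (s ∧ s′)
         (∧-disjoint-weaken p q p′ q′ pq) (∧-disjoint-weaken p r p′ r′ pr) (∧-disjoint-weaken p s p′ s′ ps)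
         (∧-disjoint-weaken q r q′ r′ qr) (∧-disjoint-weaken q s q′ s′ qs) (∧-disjoint-weaken r s r′ s′ rs) ⟩
  ind (p ∧ p′) + (ind (q ∧ q′) + (ind (r ∧ r′) + ind (s ∧ s′)))
    ≡⟨ cong₂ _+_ (ind-∧ p p′) (cong₂ _+_ (ind-∧ q q′) (cong₂ _+_ (ind-∧ r r′) (ind-∧ s s′))) ⟩
  ind p * ind p′ + (ind q * ind q′ + (ind r * ind r′ + ind s * ind s′)) ∎

countB-∷ : ∀ {A : Set} (p : A → Bool) B Bs → countB p (B ∷ Bs) ≡ ind (p B) + countB p Bs
countB-∷ p B Bs with p B
... | true  = refl
... | false = refl

countB-cong : ∀ {A : Set} {p q : A → Bool} → (∀ B → p B ≡ q B) → ∀ Bs → countB p Bs ≡ countB q Bs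
countB-cong e []       = refl
countB-cong {p = p} {q} e (B ∷ Bs) = begin
  countB p (B ∷ Bs)        ≡⟨ countB-∷ p B Bs ⟩
  ind (p B) + countB p Bs  ≡⟨ cong₂ _+_ (cong ind (e B)) (countB-cong e Bs) ⟩
  ind (q B) + countB q Bs  ≡⟨ countB-∷ q B Bs ⟨
  countB q (B ∷ Bs)        ∎

countB-none : ∀ {A : Set} {p : A → Bool} → (∀ B → p B ≡ false) → ∀ Bs → countB p Bs ≡ 0
countB-none e []       = refl
countB-none e (B ∷ Bs) rewrite e B = countB-none e Bs

sum-const : ∀ n k → sum {n} (λ _ → k) ≡ n * k
sum-const zero    k = refl
sum-const (suc n) k = cong (k +_) (sum-const n k)

sum-except : ∀ {n} (h : Fin (suc n) → ℕ) a k → (∀ b → a ≢ b → h b ≡ k) → sum h ≡ h a + n * k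
sum-except {n} h a k h≡k = begin
  sum h                     ≡⟨ sum-remove {i = a} h ⟩
  h a + sum (h ∘ punchIn a) ≡⟨ cong (h a +_) (sum-cong-≗ (λ j → h≡k (punchIn a j) (punchInᵢ≢i a j ∘ sym))) ⟩
  h a + sum {n} (λ _ → k)   ≡⟨ cong (h a +_) (sum-const n k) ⟩
  h a + n * k               ∎

sum-+₄ : ∀ {n} (f g h k : Fin n → ℕ) →
  sum (λ i → f i + (g i + (h i + k i))) ≡ sum f + (sum g + (sum h + sum k))
sum-+₄ f g h k =
  trans (∑-distrib-+ f _) (cong (sum f +_) (trans (∑-distrib-+ g _) (cong (sum g +_) (∑-distrib-+ h k))))

==-refl : ∀ {v} (a : Fin v) → (a == a) ≡ true
==-refl a = trans (isYes≗does (a ≟ a)) (dec-true (a ≟ a) refl)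

==-≢ : ∀ {v} {a b : Fin v} → a ≢ b → (a == b) ≡ false
==-≢ {a = a} {b} a≢b = trans (isYes≗does (a ≟ b)) (dec-false (a ≟ b) a≢b)

==-disjoint : ∀ {v} {c d : Fin v} → c ≢ d → ∀ a → (a == c) ∧ (a == d) ≡ false
==-disjoint {c = c} c≢d a with a ≟ c
... | yes refl = ==-≢ c≢d
... | no _     = refl

δ : ∀ {v} → Fin v → Fin v → ℕ
δ c b = ind (b == c)

sum-δ : ∀ {v} (c : Fin v) → sum (δ c) ≡ 1
sum-δ {suc n} c = begin
  sum (δ c)             ≡⟨ sum-except (δ c) c 0 (λ b c≢b → cong ind (==-≢ (c≢b ∘ sym))) ⟩
  ind (c == c) + n * 0  ≡⟨ cong₂ _+_ (cong ind (==-refl c)) (*-zeroʳ n) ⟩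
  1                     ∎

sum-*-δ : ∀ {v} k (c : Fin v) → sum (λ b → k * δ c b) ≡ k
sum-*-δ k c = begin
  sum (λ b → k * δ c b)  ≡⟨ *-distribˡ-sum k (δ c) ⟨
  k * sum (δ c)          ≡⟨ cong (k *_) (sum-δ c) ⟩
  k * 1                  ≡⟨ *-identityʳ k ⟩
  k                      ∎

samePair-irrefl : ∀ {v} {c d : Fin v} → c ≢ d → ∀ a → samePair a a c d ≡ false
samePair-irrefl {c = c} {d} c≢d a rewrite ∧-comm (a == d) (a == c) | ==-disjoint c≢d a = refl

module _ {v : ℕ} (B : NestedBlock v) where

  ind-∈B : ∀ a → ind (a ∈B B) ≡ δ (x B) a + (δ (y B) a + (δ (z B) a + δ (w B) a))
  ind-∈B a = ind-∨-disjoint₄ (a == x B) (a == y B) (a == z B) (a == w B)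
    (==-disjoint (x≢y B) a) (==-disjoint (x≢z B) a) (==-disjoint (x≢w B) a)
    (==-disjoint (y≢z B) a) (==-disjoint (y≢w B) a) (==-disjoint (z≢w B) a)

  sum-∈B : sum (λ b → ind (b ∈B B)) ≡ 4
  sum-∈B = begin
    sum (λ b → ind (b ∈B B))
      ≡⟨ trans (sum-cong-≗ ind-∈B) (sum-+₄ (δ (x B)) (δ (y B)) (δ (z B)) (δ (w B))) ⟩
    sum (δ (x B)) + (sum (δ (y B)) + (sum (δ (z B)) + sum (δ (w B))))
      ≡⟨ cong₂ _+_ (sum-δ (x B)) (cong₂ _+_ (sum-δ (y B)) (cong₂ _+_ (sum-δ (z B)) (sum-δ (w B)))) ⟩
    4 ∎

  ind-isPart : ∀ a b → ind (isPart a b B) ≡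
    ind (a == x B) * δ (y B) b + (ind (a == y B) * δ (x B) b +
    (ind (a == z B) * δ (w B) b + ind (a == w B) * δ (z B) b))
  ind-isPart a b = ind-∨-disjoint₄-∧
    (a == x B) (a == y B) (a == z B) (a == w B) (b == y B) (b == x B) (b == w B) (b == z B)
    (==-disjoint (x≢y B) a) (==-disjoint (x≢z B) a) (==-disjoint (x≢w B) a)
    (==-disjoint (y≢z B) a) (==-disjoint (y≢w B) a) (==-disjoint (z≢w B) a)

  sum-isPart : ∀ a → sum (λ b → ind (isPart a b B)) ≡ ind (a ∈B B)
  sum-isPart a = begin
    sum (λ b → ind (isPart a b B))
      ≡⟨ trans (sum-cong-≗ (ind-isPart a)) (sum-+₄ (term (x B) (y B)) (term (y B) (x B)) (term (z B) (w B)) (term (w B) (z B))) ⟩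
    sum (term (x B) (y B)) + (sum (term (y B) (x B)) + (sum (term (z B) (w B)) + sum (term (w B) (z B))))
      ≡⟨ cong₂ _+_ (sum-*-δ (δ (x B) a) (y B)) (cong₂ _+_ (sum-*-δ (δ (y B) a) (x B))
           (cong₂ _+_ (sum-*-δ (δ (z B) a) (w B)) (sum-*-δ (δ (w B) a) (z B)))) ⟩
    δ (x B) a + (δ (y B) a + (δ (z B) a + δ (w B) a))
      ≡⟨ ind-∈B a ⟨
    ind (a ∈B B) ∎
    where
    term : Fin v → Fin v → Fin v → ℕ
    term c d b = ind (a == c) * δ d b

  sum-through : ∀ a → sum (λ b → ind ((a ∈B B) ∧ (b ∈B B))) ≡ 4 * ind (a ∈B B)
  sum-through a with a ∈B B
  ... | true  = sum-∈B
  ... | false = sum-replicate-zero v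

  isPart-irrefl : ∀ a → isPart a a B ≡ false
  isPart-irrefl a = cong₂ _∨_ (samePair-irrefl (x≢y B) a) (samePair-irrefl (z≢w B) a)

sum-countB : ∀ {v} {A : Set} (P : Fin v → A → Bool) (q : A → Bool) k →
  (∀ B → sum (λ b → ind (P b B)) ≡ k * ind (q B)) →
  ∀ Bs → sum (λ b → countB (P b) Bs) ≡ k * countB q Bs
sum-countB {v} P q k _ [] = trans (sum-replicate-zero v) (sym (*-zeroʳ k))
sum-countB P q k sum-P≡ (B ∷ Bs) = begin
  sum (λ b → countB (P b) (B ∷ Bs))                     ≡⟨ sum-cong-≗ (λ b → countB-∷ (P b) B Bs) ⟩
  sum (λ b → ind (P b B) + countB (P b) Bs)             ≡⟨ ∑-distrib-+ (λ b → ind (P b B)) (λ b → countB (P b) Bs) ⟩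
  sum (λ b → ind (P b B)) + sum (λ b → countB (P b) Bs) ≡⟨ cong₂ _+_ (sum-P≡ B) (sum-countB P q k sum-P≡ Bs) ⟩
  k * ind (q B) + k * countB q Bs                       ≡⟨ *-distribˡ-+ k _ _ ⟨
  k * (ind (q B) + countB q Bs)                         ≡⟨ cong (k *_) (countB-∷ q B Bs) ⟨
  k * countB q (B ∷ Bs)                                 ∎

replication : ∀ {v} → List (NestedBlock v) → Fin v → ℕ
replication ℬ a = countB (a ∈B_) ℬ

sum-blocksThrough : ∀ {v} (ℬ : List (NestedBlock v)) a → sum (blocksThrough ℬ a) ≡ 4 * replication ℬ a
sum-blocksThrough ℬ a = sum-countB (λ b B → (a ∈B B) ∧ (b ∈B B)) (a ∈B_) 4 (λ B → sum-through B a) ℬ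

sum-multiplicity : ∀ {v} (ℬ : List (NestedBlock v)) a → sum (multiplicity ℬ a) ≡ replication ℬ a
sum-multiplicity ℬ a = trans
  (sum-countB (λ b → isPart a b) (a ∈B_) 1 (λ B → trans (sum-isPart B a) (sym (*-identityˡ _))) ℬ)
  (*-identityˡ _)

replication-design : ∀ {n λ'} (ℬ : List (NestedBlock (suc n))) → IsNestedDesign (suc n) λ' ℬ →
  ∀ a → 3 * replication ℬ a ≡ n * λ'
replication-design {n} {λ'} ℬ design a = +-cancelˡ-≡ r _ _ (begin
  r + 3 * r                     ≡⟨ sum-blocksThrough ℬ a ⟨
  sum (blocksThrough ℬ a)       ≡⟨ sum-except _ a λ' (design a) ⟩
  blocksThrough ℬ a a + n * λ'  ≡⟨ cong (_+ n * λ') (countB-cong (λ B → ∧-idem (a ∈B B)) ℬ) ⟩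
  r + n * λ'                    ∎)
  where r = replication ℬ a

replication-uniform : ∀ {n} μ (ℬ : List (NestedBlock (suc n))) →
  (∀ a b → a ≢ b → multiplicity ℬ a b ≡ μ) → ∀ a → replication ℬ a ≡ n * μ
replication-uniform {n} μ ℬ uniform a = begin
  replication ℬ a             ≡⟨ sum-multiplicity ℬ a ⟨
  sum (multiplicity ℬ a)      ≡⟨ sum-except _ a μ (uniform a) ⟩
  multiplicity ℬ a a + n * μ  ≡⟨ cong (_+ n * μ) (countB-none (λ B → isPart-irrefl B a) ℬ) ⟩
  n * μ                       ∎

lemma3p3 : (v λ' : ℕ) → 2 ≤ v → 0 < λ' →
    Σ (List (NestedBlock v)) (λ ℬ → IsNestedDesign v λ' ℬ × CompletelyUniform v ℬ) →
    λ' % 3 ≡ 0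
lemma3p3 (suc (suc n)) λ' (s≤s (s≤s z≤n)) _ (ℬ , design , μ , _ , uniform) =
  n∣m⇒m%n≡0 λ' 3 (divides μ (trans λ'≡3μ (*-comm 3 μ)))
  where
  λ'≡3μ : λ' ≡ 3 * μ
  λ'≡3μ = *-cancelˡ-≡ λ' (3 * μ) (suc n) (begin
    suc n * λ'            ≡⟨ replication-design ℬ design 0F ⟨
    3 * replication ℬ 0F  ≡⟨ cong (3 *_) (replication-uniform μ ℬ uniform 0F) ⟩
    3 * (suc n * μ)       ≡⟨ x∙yz≈y∙xz 3 (suc n) μ ⟩
    suc n * (3 * μ)       ∎)
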